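{- For every instance $\mathcal{I}$ of 3-SAT, the graph $G(\mathcal{I})$ defined in the context is weakly chordal.
   Context: Construction of $G(\mathcal{I})$ for a 3-SAT instance $\mathcal{I}$ with variables $x_1,\dots,x_k$ and clauses $c_1,\dots,c_l$ (each clause a disjunction of three literals): the vertex set consists of literal vertices $X=\{x_1,\dots,x_k,\overline{x}_1,\dots,\overline{x}_k\}$, clause vertices $C=\{c_1,\dots,c_l\}$, and three further vertices $s,b,t$. Edges: every pair of distinct literal vertices is adjacent except the pairs $x_i\overline{x}_i$ ($1\le i\le k$); $C$ is an independent set; each clause vertex $c_j$ is adjacent to every literal vertex except the literal vertices corresponding to the literals occurring in clause $c_j$; $b$ is adjacent to all literal vertices; $s$ and $t$ are each adjacent to all literal vertices and all clause vertices; and $bt$ is an edge. There are no other edges. A graph is weakly chordal if neither it nor its complement contains an induced cycle of length at least $5$. -}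

module Defs where

open import Data.Nat using (ℕ; zero; suc; _≤_; _∸_)
open import Data.Fin using (Fin; toℕ)
open import Data.Bool using (Bool; true; false)
open import Data.Product using (_×_; _,_; ∃-syntax; Σ)
open import Data.Sum using (_⊎_)
open import Data.Empty using (⊥)
open import Data.Unit using (⊤)
open import Relation.Nullary using (¬_)
open import Relation.Binary.PropositionalEquality using (_≡_; _≢_)
open import Function.Bundles using (_⇔_)
open import Function.Definitions using (Injective)

CycSucc : ∀ {n} → Fin n → Fin n → Set
CycSucc {n} i j = (toℕ j ≡ suc (toℕ i)) ⊎ (toℕ i ≡ n ∸ 1 × toℕ j ≡ 0)

CycAdj : ∀ {n} → Fin n → Fin n → Set
CycAdj i j = CycSucc i j ⊎ CycSucc j i

InducedCycle : {V : Set} → (V → V → Set) → ℕ → Set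
InducedCycle {V} E n =
  Σ (Fin n → V) λ f →
    Injective _≡_ _≡_ f ×
    (∀ i j → i ≢ j → E (f i) (f j) ⇔ CycAdj i j)

Compl : {V : Set} → (V → V → Set) → V → V → Set
Compl E u v = u ≢ v × ¬ E u v

WeaklyChordal : {V : Set} → (V → V → Set) → Set
WeaklyChordal E = ∀ n → 5 ≤ n → ¬ InducedCycle E n × ¬ InducedCycle (Compl E) n

-- A literal over variables x_0..x_{k-1}: (i , true) is x_i, (i , false) is ¬x_i
Literal : ℕ → Set
Literal k = Fin k × Bool

record Instance : Set where
  field
    k       : ℕ
    l       : ℕ
    clause  : Fin l → Fin 3 → Literal k

Occurs : (I : Instance) → Literal (Instance.k I) → Fin (Instance.l I) → Set
Occurs I a j = ∃[ r ] Instance.clause I j r ≡ a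

data Vtx (I : Instance) : Set where
  lit : Literal (Instance.k I) → Vtx I
  cl  : Fin (Instance.l I) → Vtx I
  s b t : Vtx I

Complementary : ∀ {k} → Literal k → Literal k → Set
Complementary (i , p) (j , q) = i ≡ j × p ≢ q

Adj : (I : Instance) → Vtx I → Vtx I → Set
Adj I (lit a) (lit a') = a ≢ a' × ¬ Complementary a a'
Adj I (cl j) (lit a) = ¬ Occurs I a j
Adj I (lit a) (cl j) = ¬ Occurs I a j
Adj I (cl _) (cl _) = ⊥
Adj I b (lit _) = ⊤
Adj I (lit _) b = ⊤
Adj I b t = ⊤
Adj I t b = ⊤
Adj I s (lit _) = ⊤
Adj I (lit _) s = ⊤
Adj I s (cl _) = ⊤
Adj I (cl _) s = ⊤
Adj I t (lit _) = ⊤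
Adj I (lit _) t = ⊤
Adj I t (cl _) = ⊤
Adj I (cl _) t = ⊤
Adj I _ _ = ⊥

G : (I : Instance) → Vtx I → Vtx I → Set
G = Adj

module Submission where

-- Walk periodically around a hole of length at least five, in G or in its complement: the two
-- neighbours of a vertex are distinct and non-adjacent, and so are the two vertices two steps away.
-- In G, the only non-neighbour of t is s, and then the only one of s is b; a clause on the hole has
-- complementary neighbours x̄ and x, which forces the vertex before x̄ to be a clause and the one
-- before that to be x again, four steps from the first x; with clauses gone, b and each literal
-- are again left with a single possible non-neighbour. In the complement, the neighbourhoods of t,
-- s and b are cliques (the clauses form a clique); a literal x is adjacent only to x̄ and to
-- clauses, and a clause next to it forces x̄ on its other side and then a second clause three
-- steps from the first; and a hole of clauses alone is a clique.

open import Defs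
open import Data.Bool using (not)
import Data.Bool as Bool
open import Data.Bool.Properties using (¬-not; not-involutive)
open import Data.Empty using (⊥; ⊥-elim)
open import Data.Fin using (Fin; toℕ)
import Data.Fin as Fin
open import Data.Fin.Properties using (toℕ-injective; toℕ<n; toℕ-fromℕ<)
open import Data.Nat using (ℕ; zero; suc; _+_; _∸_; _≤_; _<_; s≤s; z≤n)
open import Data.Nat.Divisibility using (∣-refl)
open import Data.Nat.DivMod
  using (_%_; _mod_; m%n<n; m<n⇒m%n≡m; %-pred-≡0; %-remove-+ˡ; m<[1+n%d]⇒m≤[n%d]; [1+m%d]≤1+n⇒[m%d]≤n)
open import Data.Nat.Properties
  using (1+n≢0; ≤-refl; ≤-trans; ≤-antisym; <-irrefl; suc-injective; +-suc; +-identityʳ; +-assoc; m≤m+n; m≤n+m; m+[n∸m]≡n)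
open import Data.Product using (_×_; _,_; proj₁; proj₂; ∃-syntax)
open import Data.Sum using (_⊎_; inj₁; inj₂; swap; fromInj₁; fromInj₂)
open import Function using (_∘_)
open import Function.Bundles using (Equivalence)
open import Relation.Nullary using (¬_; yes; no)
open import Relation.Binary.PropositionalEquality
  using (_≡_; _≢_; refl; sym; trans; cong; subst; ≢-sym; module ≡-Reasoning)

module _ {n : ℕ} where

  toℕ-mod : ∀ k → toℕ (k mod suc n) ≡ k % suc n
  toℕ-mod k = toℕ-fromℕ< (m%n<n k (suc n))

  %-suc : ∀ k → suc k % suc n ≡ suc (k % suc n) ⊎ (k % suc n ≡ n × suc k % suc n ≡ 0)
  %-suc k with suc k % suc n in eq
  ... | zero  = inj₂ (%-pred-≡0 eq , refl)
  ... | suc r = inj₁ (cong suc (≤-antisym r≤k%n k%n≤r))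
    where
    r≤k%n : r ≤ k % suc n
    r≤k%n = m<[1+n%d]⇒m≤[n%d] k (suc n) (subst (r <_) (sym eq) ≤-refl)
    k%n≤r : k % suc n ≤ r
    k%n≤r = [1+m%d]≤1+n⇒[m%d]≤n k r (suc n) (subst (0 <_) (sym eq) (s≤s z≤n)) (subst (_≤ suc r) (sym eq) ≤-refl)

  CycSucc-mod : ∀ k → CycSucc (k mod suc n) (suc k mod suc n)
  CycSucc-mod k rewrite toℕ-mod k | toℕ-mod (suc k) = %-suc k

  CycSucc-functional : {i j j′ : Fin (suc n)} → CycSucc i j → CycSucc i j′ → j ≡ j′
  CycSucc-functional (inj₁ j≡1+i) (inj₁ j′≡1+i) = toℕ-injective (trans j≡1+i (sym j′≡1+i))
  CycSucc-functional (inj₂ (_ , j≡0)) (inj₂ (_ , j′≡0)) = toℕ-injective (trans j≡0 (sym j′≡0))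
  CycSucc-functional {j = j} (inj₁ j≡1+i) (inj₂ (i≡n , _)) =
    ⊥-elim (<-irrefl (trans j≡1+i (cong suc i≡n)) (toℕ<n j))
  CycSucc-functional {j′ = j′} (inj₂ (i≡n , _)) (inj₁ j′≡1+i) =
    ⊥-elim (<-irrefl (trans j′≡1+i (cong suc i≡n)) (toℕ<n j′))

  CycSucc-injective : {i i′ j : Fin (suc n)} → CycSucc i j → CycSucc i′ j → i ≡ i′
  CycSucc-injective (inj₁ j≡1+i) (inj₁ j≡1+i′) = toℕ-injective (suc-injective (trans (sym j≡1+i) j≡1+i′))
  CycSucc-injective (inj₂ (i≡n , _)) (inj₂ (i′≡n , _)) = toℕ-injective (trans i≡n (sym i′≡n))
  CycSucc-injective (inj₁ j≡1+i) (inj₂ (_ , j≡0)) with () ← trans (sym j≡1+i) j≡0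
  CycSucc-injective (inj₂ (_ , j≡0)) (inj₁ j≡1+i′) with () ← trans (sym j≡1+i′) j≡0

  mod-suc-injective : ∀ {x y} → suc x mod suc n ≡ suc y mod suc n → x mod suc n ≡ y mod suc n
  mod-suc-injective {x} {y} eq =
    CycSucc-injective (CycSucc-mod x) (subst (CycSucc _) (sym eq) (CycSucc-mod y))

  mod-cancelʳ : ∀ k {x y} → (x + k) mod suc n ≡ (y + k) mod suc n → x mod suc n ≡ y mod suc n
  mod-cancelʳ zero {x} {y} rewrite +-identityʳ x | +-identityʳ y = λ eq → eq
  mod-cancelʳ (suc k) {x} {y} rewrite +-suc x k | +-suc y k = mod-cancelʳ k {x} {y} ∘ mod-suc-injective {x + k} {y + k}

  mod-distinct : ∀ d k → d < n → (suc d + k) mod suc n ≢ k mod suc n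
  mod-distinct d k d<n eq = 1+n≢0 1+d≡0
    where
    open ≡-Reasoning
    1+d≡0 : suc d ≡ 0
    1+d≡0 = begin
      suc d                 ≡⟨ m<n⇒m%n≡m (s≤s d<n) ⟨
      suc d % suc n         ≡⟨ toℕ-mod (suc d) ⟨
      toℕ (suc d mod suc n) ≡⟨ cong toℕ (mod-cancelʳ k {suc d} {0} eq) ⟩
      toℕ (0 mod suc n)     ≡⟨ toℕ-mod 0 ⟩
      0                     ∎

  mod-nonadjacent : ∀ d k → 2 + d < n → ¬ CycAdj (k mod suc n) ((2 + d + k) mod suc n)
  mod-nonadjacent d k 2+d<n (inj₁ forward) =
    mod-distinct d k (≤-trans (m≤n+m (suc d) 2) 2+d<n)
      (sym (mod-suc-injective (CycSucc-functional (CycSucc-mod k) forward)))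
  mod-nonadjacent d k 2+d<n (inj₂ backward) =
    mod-distinct (2 + d) k 2+d<n (CycSucc-functional (CycSucc-mod (2 + d + k)) backward)

  mod-periodic : ∀ k → (suc n + k) mod suc n ≡ k mod suc n
  mod-periodic k = toℕ-injective (begin
    toℕ ((suc n + k) mod suc n) ≡⟨ toℕ-mod (suc n + k) ⟩
    (suc n + k) % suc n         ≡⟨ %-remove-+ˡ k ∣-refl ⟩
    k % suc n                   ≡⟨ toℕ-mod k ⟨
    toℕ (k mod suc n)           ∎)
    where open ≡-Reasoning

record InducedPath₄ {V : Set} (_∼_ : V → V → Set) (v₀ v₁ v₂ v₃ : V) : Set where
  field
    v₀∼v₁ : v₀ ∼ v₁
    v₁∼v₂ : v₁ ∼ v₂
    v₂∼v₃ : v₂ ∼ v₃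
    v₀≁v₂ : ¬ v₀ ∼ v₂
    v₁≁v₃ : ¬ v₁ ∼ v₃
    v₀≁v₃ : ¬ v₀ ∼ v₃
    v₀≢v₂ : v₀ ≢ v₂
    v₁≢v₃ : v₁ ≢ v₃
    v₀≢v₃ : v₀ ≢ v₃

record Hole {V : Set} (_∼_ : V → V → Set) : Set where
  field
    vertex        : ℕ → V
    period        : ℕ
    5≤period      : 5 ≤ period
    periodic      : ∀ k → vertex (period + k) ≡ vertex k
    path          : ∀ k → InducedPath₄ _∼_ (vertex k) (vertex (1 + k)) (vertex (2 + k)) (vertex (3 + k))
    path-reversed : ∀ k → InducedPath₄ _∼_ (vertex (3 + k)) (vertex (2 + k)) (vertex (1 + k)) (vertex k)
    v₀≢v₄         : ∀ k → vertex k ≢ vertex (4 + k)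

hole-of-cycle : ∀ {V : Set} {_∼_ : V → V → Set} {n} → 5 ≤ n → InducedCycle _∼_ n → Hole _∼_
-- Matching on 5≤n exposes n = 4 + m, so each bound on a literal offset below is  m≤m+n _ _ .
hole-of-cycle {V} {_∼_} {suc n} 5≤n@(s≤s (s≤s (s≤s (s≤s (s≤s _))))) (f , f-injective , f-induced) = record
  { vertex        = vertex
  ; period        = suc n
  ; 5≤period      = 5≤n
  ; periodic      = cong f ∘ mod-periodic
  ; path          = λ k → record
    { v₀∼v₁ = proj₁ (edge k)
    ; v₁∼v₂ = proj₁ (edge (1 + k))
    ; v₂∼v₃ = proj₁ (edge (2 + k))
    ; v₀≁v₂ = proj₁ (chordless 0 k (m≤m+n _ _))
    ; v₁≁v₃ = proj₁ (chordless 0 (1 + k) (m≤m+n _ _))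
    ; v₀≁v₃ = proj₁ (chordless 1 k (m≤m+n _ _))
    ; v₀≢v₂ = ≢-sym (apart 1 k (m≤m+n _ _))
    ; v₁≢v₃ = ≢-sym (apart 1 (1 + k) (m≤m+n _ _))
    ; v₀≢v₃ = ≢-sym (apart 2 k (m≤m+n _ _))
    }
  ; path-reversed = λ k → record
    { v₀∼v₁ = proj₂ (edge (2 + k))
    ; v₁∼v₂ = proj₂ (edge (1 + k))
    ; v₂∼v₃ = proj₂ (edge k)
    ; v₀≁v₂ = proj₂ (chordless 0 (1 + k) (m≤m+n _ _))
    ; v₁≁v₃ = proj₂ (chordless 0 k (m≤m+n _ _))
    ; v₀≁v₃ = proj₂ (chordless 1 k (m≤m+n _ _))
    ; v₀≢v₂ = apart 1 (1 + k) (m≤m+n _ _)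
    ; v₁≢v₃ = apart 1 k (m≤m+n _ _)
    ; v₀≢v₃ = apart 2 k (m≤m+n _ _)
    }
  ; v₀≢v₄         = λ k → ≢-sym (apart 3 k (m≤m+n _ _))
  }
  where
  vertex : ℕ → V
  vertex k = f (k mod suc n)

  apart : ∀ d k → d < n → vertex (suc d + k) ≢ vertex k
  apart d k d<n = mod-distinct d k d<n ∘ f-injective

  edge : ∀ k → vertex k ∼ vertex (1 + k) × vertex (1 + k) ∼ vertex k
  edge k = Equivalence.from (f-induced _ _ (≢-sym (mod-distinct 0 k (m≤m+n _ _)))) (inj₁ (CycSucc-mod k))
         , Equivalence.from (f-induced _ _ (mod-distinct 0 k (m≤m+n _ _))) (inj₂ (CycSucc-mod k))

  chordless : ∀ d k → 2 + d < n → ¬ vertex k ∼ vertex (2 + d + k) × ¬ vertex (2 + d + k) ∼ vertex k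
  chordless d k 2+d<n =
      mod-nonadjacent d k 2+d<n ∘ Equivalence.to (f-induced _ _ (≢-sym (mod-distinct (suc d) k d+1<n)))
    , mod-nonadjacent d k 2+d<n ∘ swap ∘ Equivalence.to (f-induced _ _ (mod-distinct (suc d) k d+1<n))
    where
    d+1<n : suc d < n
    d+1<n = ≤-trans (m≤n+m (suc (suc d)) 1) 2+d<n

module HoleProperties {V : Set} {_∼_ : V → V → Set} (h : Hole _∼_) where
  open Hole h

  shift-∀ : ∀ {P : V → Set} j → j ≤ period → (∀ k → P (vertex (j + k))) → ∀ k → P (vertex k)
  shift-∀ {P} j j≤period P-from-j k = subst P (trans (cong vertex j+[p∸j+k]≡p+k) (periodic k)) (P-from-j (period ∸ j + k))
    where
    j+[p∸j+k]≡p+k : j + (period ∸ j + k) ≡ period + k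
    j+[p∸j+k]≡p+k = trans (sym (+-assoc j (period ∸ j) k)) (cong (_+ k) (m+[n∸m]≡n j≤period))

  unique-nonneighbour⇒absent : ∀ {x y} → (∀ {i} → Compl _∼_ (vertex i) x → vertex i ≡ y) → ∀ k → vertex k ≢ x
  unique-nonneighbour⇒absent {x} unique = shift-∀ {_≢ x} 2 (≤-trans (m≤m+n 2 3) 5≤period) absent
    where
    absent : ∀ k → vertex (2 + k) ≢ x
    absent k v≡x = v₀≢v₄ k (trans (unique (subst (Compl _∼_ _) v≡x (P.v₀≢v₂ , P.v₀≁v₂)))
                                  (sym (unique (subst (Compl _∼_ _) v≡x (R.v₀≢v₂ , R.v₀≁v₂)))))
      where
      module P = InducedPath₄ (path k)
      module R = InducedPath₄ (path-reversed (1 + k))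

  simplicial⇒absent : ∀ {x} → (∀ {i j} → vertex i ∼ x → vertex j ∼ x → vertex i ≢ vertex j → vertex i ∼ vertex j)
                    → ∀ k → vertex k ≢ x
  simplicial⇒absent {x} clique = shift-∀ {_≢ x} 1 (≤-trans (m≤m+n 1 4) 5≤period) absent
    where
    absent : ∀ k → vertex (1 + k) ≢ x
    absent k v≡x = P.v₀≁v₂ (clique {k} {2 + k} (subst (_ ∼_) v≡x P.v₀∼v₁) (subst (_ ∼_) v≡x R.v₁∼v₂) P.v₀≢v₂)
      where
      module P = InducedPath₄ (path k)
      module R = InducedPath₄ (path-reversed k)

complement : ∀ {k} → Literal k → Literal k
complement (i , p) = i , not p

complement-involutive : ∀ {k} (a : Literal k) → complement (complement a) ≡ a
complement-involutive (i , p) = cong (i ,_) (not-involutive p)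

IsClause : ∀ {I} → Vtx I → Set
IsClause {I} v = ∃[ j ] v ≡ cl j

module _ {I : Instance} where

  lit-injective : ∀ {a a′} → lit {I} a ≡ lit a′ → a ≡ a′
  lit-injective refl = refl

  Adj-irreflexive : ∀ {u : Vtx I} → ¬ Adj I u u
  Adj-irreflexive {lit _} (a≢a , _) = a≢a refl

  nonadjacent-literals : ∀ {a a′} → a ≢ a′ → ¬ Adj I (lit a) (lit a′) → a ≡ complement a′
  nonadjacent-literals {i , p} {j , q} a≢a′ ¬adj with i Fin.≟ j | p Bool.≟ q
  ... | no i≢j    | _        = ⊥-elim (¬adj (a≢a′ , i≢j ∘ proj₁))
  ... | yes refl  | yes refl = ⊥-elim (a≢a′ refl)
  ... | yes refl  | no p≢q   = cong (i ,_) (¬-not p≢q)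

  nonneighbour-of-t : ∀ {u : Vtx I} → Compl (Adj I) u t → u ≡ s
  nonneighbour-of-t {lit _} (_ , ¬adj) = ⊥-elim (¬adj _)
  nonneighbour-of-t {cl _}  (_ , ¬adj) = ⊥-elim (¬adj _)
  nonneighbour-of-t {s}     _          = refl
  nonneighbour-of-t {b}     (_ , ¬adj) = ⊥-elim (¬adj _)
  nonneighbour-of-t {t}     (u≢t , _)  = ⊥-elim (u≢t refl)

  nonneighbour-of-s : ∀ {u : Vtx I} → Compl (Adj I) u s → u ≡ t ⊎ u ≡ b
  nonneighbour-of-s {lit _} (_ , ¬adj) = ⊥-elim (¬adj _)
  nonneighbour-of-s {cl _}  (_ , ¬adj) = ⊥-elim (¬adj _)
  nonneighbour-of-s {s}     (u≢s , _)  = ⊥-elim (u≢s refl)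
  nonneighbour-of-s {b}     _          = inj₂ refl
  nonneighbour-of-s {t}     _          = inj₁ refl

  nonneighbour-of-b : ∀ {u : Vtx I} → Compl (Adj I) u b → u ≡ s ⊎ IsClause u
  nonneighbour-of-b {lit _} (_ , ¬adj) = ⊥-elim (¬adj _)
  nonneighbour-of-b {cl j}  _          = inj₂ (j , refl)
  nonneighbour-of-b {s}     _          = inj₁ refl
  nonneighbour-of-b {b}     (u≢b , _)  = ⊥-elim (u≢b refl)
  nonneighbour-of-b {t}     (_ , ¬adj) = ⊥-elim (¬adj _)

  nonneighbour-of-literal : ∀ {u : Vtx I} {a} → Compl (Adj I) u (lit a) → u ≡ lit (complement a) ⊎ IsClause u
  nonneighbour-of-literal {lit a′} (u≢a , ¬adj) = inj₁ (cong lit (nonadjacent-literals (u≢a ∘ cong lit) ¬adj))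
  nonneighbour-of-literal {cl j}   _            = inj₂ (j , refl)
  nonneighbour-of-literal {s}      (_ , ¬adj)   = ⊥-elim (¬adj _)
  nonneighbour-of-literal {b}      (_ , ¬adj)   = ⊥-elim (¬adj _)
  nonneighbour-of-literal {t}      (_ , ¬adj)   = ⊥-elim (¬adj _)

  adjacent-to-complement-only⇒clause : ∀ {u : Vtx I} {a} → Adj I u (lit (complement a)) → Compl (Adj I) u (lit a)
                                     → IsClause u
  adjacent-to-complement-only⇒clause {a = a} u∼¬a u≁a =
    fromInj₂ (λ u≡¬a → ⊥-elim (Adj-irreflexive (subst (λ v → Adj I v (lit (complement a))) u≡¬a u∼¬a)))
             (nonneighbour-of-literal u≁a)

  clauses-coadjacent : ∀ {u w : Vtx I} → IsClause u → IsClause w → u ≢ w → Compl (Adj I) u w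
  clauses-coadjacent (_ , refl) (_ , refl) u≢w = u≢w , λ ()

  clause-neighbours : ∀ {u c w : Vtx I} → IsClause c → u ≢ s → u ≢ t → w ≢ s → w ≢ t
                    → Adj I u c → Adj I c w → u ≢ w → ¬ Adj I u w
                    → ∃[ a ] u ≡ lit (complement a) × w ≡ lit a
  clause-neighbours {lit a} {_} {lit a′} (_ , refl) _ _ _ _ _ _ u≢w ¬adj =
    a′ , cong lit (nonadjacent-literals (u≢w ∘ cong lit) ¬adj) , refl
  clause-neighbours {lit _} {_} {cl _} (_ , refl) _ _ _ _ _ ()
  clause-neighbours {lit _} {_} {s}    (_ , refl) _ _ w≢s _ = ⊥-elim (w≢s refl)
  clause-neighbours {lit _} {_} {b}    (_ , refl) _ _ _ _ _ ()
  clause-neighbours {lit _} {_} {t}    (_ , refl) _ _ _ w≢t = ⊥-elim (w≢t refl)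
  clause-neighbours {cl _}             (_ , refl) _ _ _ _ ()
  clause-neighbours {s}                (_ , refl) u≢s = ⊥-elim (u≢s refl)
  clause-neighbours {b}                (_ , refl) _ _ _ _ ()
  clause-neighbours {t}                (_ , refl) _ u≢t = ⊥-elim (u≢t refl)

  coinduced-path-literal-clause : ∀ {u₀ u₁ u₃ : Vtx I} {a}
                                → InducedPath₄ (Compl (Adj I)) u₀ u₁ (lit a) u₃ → ¬ IsClause u₃
  coinduced-path-literal-clause {u₀} {u₁} {a = a} path u₃-clause = P.v₀≁v₃ (clauses-coadjacent u₀-clause u₃-clause P.v₀≢v₃)
    where
    module P = InducedPath₄ path
    u₁-not-clause : ¬ IsClause u₁
    u₁-not-clause u₁-clause = P.v₁≁v₃ (clauses-coadjacent u₁-clause u₃-clause P.v₁≢v₃)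
    u₁≡¬a : u₁ ≡ lit (complement a)
    u₁≡¬a = fromInj₁ (⊥-elim ∘ u₁-not-clause) (nonneighbour-of-literal P.v₁∼v₂)
    u₀-clause : IsClause u₀
    u₀-clause = fromInj₂ (⊥-elim ∘ P.v₀≢v₂ ∘ λ u₀≡¬¬a → trans u₀≡¬¬a (cong lit (complement-involutive a)))
                         (nonneighbour-of-literal (subst (Compl (Adj I) u₀) u₁≡¬a P.v₀∼v₁))

module HoleInG {I : Instance} (h : Hole (Adj I)) where
  open Hole h
  open HoleProperties h

  no-t : ∀ k → vertex k ≢ t
  no-t = unique-nonneighbour⇒absent nonneighbour-of-t

  no-s : ∀ k → vertex k ≢ s
  no-s = unique-nonneighbour⇒absent λ {i} → fromInj₂ (⊥-elim ∘ no-t i) ∘ nonneighbour-of-s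

  no-clause : ∀ k → ¬ IsClause (vertex k)
  no-clause = shift-∀ {¬_ ∘ IsClause} 3 (≤-trans (m≤m+n 3 2) 5≤period) absent
    where
    open ≡-Reasoning
    absent : ∀ k → ¬ IsClause (vertex (3 + k))
    absent k w₃-clause =
      let a , w₂≡¬a , w₄≡a = clause-neighbours w₃-clause (no-s (2 + k)) (no-t (2 + k)) (no-s (4 + k)) (no-t (4 + k))
                                                Q.v₁∼v₂ Q.v₂∼v₃ Q.v₁≢v₃ Q.v₁≁v₃
          w₁-clause = adjacent-to-complement-only⇒clause (subst (Adj I (vertex (1 + k))) w₂≡¬a Q.v₀∼v₁)
                        (subst (Compl (Adj I) (vertex (1 + k))) w₄≡a (Q.v₀≢v₃ , Q.v₀≁v₃))
          a′ , w₀≡¬a′ , w₂≡a′ = clause-neighbours w₁-clause (no-s k) (no-t k) (no-s (2 + k)) (no-t (2 + k))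
                                                  P.v₀∼v₁ P.v₁∼v₂ P.v₀≢v₂ P.v₀≁v₂
      in v₀≢v₄ k (begin
        vertex k                         ≡⟨ w₀≡¬a′ ⟩
        lit (complement a′)              ≡⟨ cong (lit ∘ complement) (lit-injective (trans (sym w₂≡a′) w₂≡¬a)) ⟩
        lit (complement (complement a))  ≡⟨ cong lit (complement-involutive a) ⟩
        lit a                            ≡⟨ w₄≡a ⟨
        vertex (4 + k)                   ∎)
      where
      module P = InducedPath₄ (path k)
      module Q = InducedPath₄ (path (1 + k))

  no-b : ∀ k → vertex k ≢ b
  no-b = unique-nonneighbour⇒absent λ {i} → fromInj₁ (⊥-elim ∘ no-clause i) ∘ nonneighbour-of-b

  no-literal : ∀ k a → vertex k ≢ lit a
  no-literal k a = unique-nonneighbour⇒absent (λ {i} → fromInj₁ (⊥-elim ∘ no-clause i) ∘ nonneighbour-of-literal) k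

  impossible : ⊥
  impossible with vertex 0 in v₀≡
  ... | lit a = no-literal 0 a v₀≡
  ... | cl j  = no-clause 0 (j , v₀≡)
  ... | s     = no-s 0 v₀≡
  ... | b     = no-b 0 v₀≡
  ... | t     = no-t 0 v₀≡

module HoleInComplement {I : Instance} (h : Hole (Compl (Adj I))) where
  open Hole h
  open HoleProperties h

  no-t : ∀ k → vertex k ≢ t
  no-t = simplicial⇒absent λ u∼t w∼t u≢w →
    ⊥-elim (u≢w (trans (nonneighbour-of-t u∼t) (sym (nonneighbour-of-t w∼t))))

  no-s : ∀ k → vertex k ≢ s
  no-s = simplicial⇒absent λ {i} {j} u∼s w∼s u≢w → ⊥-elim (u≢w (trans (only-b i u∼s) (sym (only-b j w∼s))))
    where
    only-b : ∀ i → Compl (Adj I) (vertex i) s → vertex i ≡ b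
    only-b i = fromInj₂ (⊥-elim ∘ no-t i) ∘ nonneighbour-of-s

  no-b : ∀ k → vertex k ≢ b
  no-b = simplicial⇒absent λ {i} {j} u∼b w∼b → clauses-coadjacent (clause i u∼b) (clause j w∼b)
    where
    clause : ∀ i → Compl (Adj I) (vertex i) b → IsClause (vertex i)
    clause i = fromInj₂ (⊥-elim ∘ no-s i) ∘ nonneighbour-of-b

  no-literal : ∀ k a → vertex k ≢ lit a
  no-literal k a = shift-∀ {_≢ lit a} 2 (≤-trans (m≤m+n 2 3) 5≤period) absent k
    where
    absent : ∀ k → vertex (2 + k) ≢ lit a
    absent k w₂≡a = P.v₁≢v₃ (trans w₁≡¬a (sym w₃≡¬a))
      where
      module P = InducedPath₄ (path k)
      module R = InducedPath₄ (path-reversed k)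
      w₁-not-clause : ¬ IsClause (vertex (1 + k))
      w₁-not-clause = coinduced-path-literal-clause
        (subst (λ v → InducedPath₄ _ (vertex (4 + k)) (vertex (3 + k)) v (vertex (1 + k))) w₂≡a (path-reversed (1 + k)))
      w₃-not-clause : ¬ IsClause (vertex (3 + k))
      w₃-not-clause = coinduced-path-literal-clause
        (subst (λ v → InducedPath₄ _ (vertex k) (vertex (1 + k)) v (vertex (3 + k))) w₂≡a (path k))
      w₁≡¬a : vertex (1 + k) ≡ lit (complement a)
      w₁≡¬a = fromInj₁ (⊥-elim ∘ w₁-not-clause) (nonneighbour-of-literal (subst (Compl (Adj I) _) w₂≡a P.v₁∼v₂))
      w₃≡¬a : vertex (3 + k) ≡ lit (complement a)
      w₃≡¬a = fromInj₁ (⊥-elim ∘ w₃-not-clause) (nonneighbour-of-literal (subst (Compl (Adj I) _) w₂≡a R.v₀∼v₁))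

  clause : ∀ k → IsClause (vertex k)
  clause k with vertex k in vₖ≡
  ... | lit a = ⊥-elim (no-literal k a vₖ≡)
  ... | cl j  = j , refl
  ... | s     = ⊥-elim (no-s k vₖ≡)
  ... | b     = ⊥-elim (no-b k vₖ≡)
  ... | t     = ⊥-elim (no-t k vₖ≡)

  impossible : ⊥
  impossible = P.v₀≁v₂ (clauses-coadjacent (clause 0) (clause 2) P.v₀≢v₂)
    where
    module P = InducedPath₄ (path 0)

lemma7 : (I : Instance) → WeaklyChordal (G I)
lemma7 I n 5≤n = (λ cycle → HoleInG.impossible (hole-of-cycle 5≤n cycle))
               , (λ cycle → HoleInComplement.impossible (hole-of-cycle 5≤n cycle))
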